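{- Let $G$ be a connected $3K_1$-free graph. Then for every two distinct vertices $u,v\in V(G)$, $G$ has a path cover $\mathrm{PC}(u,v)$.
   Context: Graphs are finite, simple and undirected. A graph is $3K_1$-free if it contains no three pairwise non-adjacent vertices. A path cover $\mathrm{PC}(u,v)$ of $G$ is a pair of vertex-disjoint paths in $G$ which together contain all vertices of $G$, such that one path starts (has an end-vertex) at $u$ and the other path starts at $v$ (a path may consist of a single vertex). -}

module Defs where

open import Data.Nat using (ℕ)
open import Data.Fin using (Fin)
open import Data.List using (List; []; _∷_; last)
open import Data.Maybe using (just)
open import Data.Product using (Σ; _×_; ∃-syntax)
open import Data.Sum using (_⊎_)
open import Data.Empty using (⊥)
open import Relation.Nullary using (¬_)
open import Relation.Binary using (Rel; Symmetric; Irreflexive; Decidable)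
open import Relation.Binary.PropositionalEquality using (_≡_)
open import Data.List.Membership.Propositional using (_∈_)
open import Data.List.Relation.Unary.Unique.Propositional using (Unique)
open import Data.List.Relation.Unary.AllPairs using (AllPairs)
open import Level using (0ℓ)

record Graph (n : ℕ) : Set₁ where
  field
    Adj     : Rel (Fin n) 0ℓ
    adj?    : Decidable Adj
    sym     : Symmetric Adj
    irrefl  : Irreflexive _≡_ Adj
open Graph public

module _ {n : ℕ} (G : Graph n) where

  data Chain : List (Fin n) → Set where
    []  : Chain []
    [-] : ∀ x → Chain (x ∷ [])
    _∷_ : ∀ {x y xs} → Adj G x y → Chain (y ∷ xs) → Chain (x ∷ y ∷ xs)

  record IsPath (p : List (Fin n)) : Set where
    field
      nonempty : ¬ (p ≡ [])
      chain    : Chain p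
      distinct : Unique p

  StartsAt : Fin n → List (Fin n) → Set
  StartsAt x [] = ⊥
  StartsAt x (y ∷ _) = x ≡ y

  Connected : Set
  Connected = ∀ (x y : Fin n) → ∃[ p ] (IsPath p × StartsAt x p × last p ≡ just y)

  ThreeK1Free : Set
  ThreeK1Free = ∀ (x y z : Fin n) → ¬ (x ≡ y) → ¬ (x ≡ z) → ¬ (y ≡ z) →
    ¬ (¬ Adj G x y × ¬ Adj G x z × ¬ Adj G y z)

  record PathCover (u v : Fin n) : Set where
    field
      P Q       : List (Fin n)
      P-path    : IsPath P
      Q-path    : IsPath Q
      P-start   : StartsAt u P
      Q-start   : StartsAt v Q
      disjoint  : ∀ x → x ∈ P → x ∈ Q → ⊥
      covers    : ∀ x → x ∈ P ⊎ x ∈ Q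

-- Grow two disjoint paths, one ending at u and one at v, one vertex at a time.  A new
-- vertex w adjacent to some covered x is appended to a free end p or q if it is adjacent
-- to it.  Otherwise 3K₁-freeness of {w, p, q} forces p ~ q, so the two paths join into a
-- single path from u to v; cutting it just after x and attaching w there gives two paths
-- again.  Connectivity supplies, for each vertex, a path from u along which it is reached.
module Submission where

open import Defs
open import Data.Nat using (ℕ)
open import Data.Fin using (Fin; _≟_)
open import Data.List using (List; []; _∷_; _++_; _ʳ++_; reverse; allFin; last)
open import Data.List.Properties using (++-assoc)
open import Data.Maybe using (just)
open import Data.List.Membership.Propositional using (_∈_; _∉_)
open import Data.List.Membership.Propositional.Properties
  using (∈-++⁺ˡ; ∈-++⁺ʳ; ∈-++⁻; ∈-∃++; ∈-allFin)
open import Data.List.Relation.Binary.Subset.Propositional using (_⊆_)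
open import Data.List.Relation.Unary.Any using (here; there)
open import Data.List.Relation.Unary.All using ([]; _∷_) renaming (lookup to All-lookup)
open import Data.List.Relation.Unary.All.Properties using (¬Any⇒All¬; ++⁻ˡ)
open import Data.List.Relation.Unary.AllPairs using ([]; _∷_)
open import Data.List.Relation.Unary.Unique.Propositional using (Unique)
open import Data.List.Relation.Unary.Unique.Propositional.Properties using (Unique[x∷xs]⇒x∉xs)
open import Data.List.Relation.Binary.Permutation.Propositional
  using (_↭_; ↭-prep; ↭-sym; ↭⇒↭ₛ; module PermutationReasoning)
open import Data.List.Relation.Binary.Permutation.Propositional.Properties
  using (∈-resp-↭; ++⁺ˡ; shifts; ++-comm; ++↭ʳ++; ↭-reverse)
import Data.List.Relation.Binary.Permutation.Setoid.Properties as PermutationSetoid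
open import Data.Product using (Σ; _×_; _,_; proj₁; proj₂)
open import Data.Sum using (inj₁; inj₂)
import Data.Sum as Sum
open import Data.Empty using (⊥-elim)
open import Function using (_∘_)
open import Relation.Nullary using (¬_; yes; no)
open import Relation.Binary.PropositionalEquality using (_≡_; refl; cong; setoid)

module _ {A : Set} where

  Unique-resp-↭ : {xs ys : List A} → xs ↭ ys → Unique xs → Unique ys
  Unique-resp-↭ p = PermutationSetoid.Unique-resp-↭ (setoid A) (↭⇒↭ₛ p)

  Unique-++⁻ˡ : ∀ xs {ys : List A} → Unique (xs ++ ys) → Unique xs
  Unique-++⁻ˡ []       _        = []
  Unique-++⁻ˡ (x ∷ xs) (x∉ ∷ u) = ++⁻ˡ xs x∉ ∷ Unique-++⁻ˡ xs u

  Unique-++⁻ʳ : ∀ xs {ys : List A} → Unique (xs ++ ys) → Unique ys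
  Unique-++⁻ʳ []       u       = u
  Unique-++⁻ʳ (x ∷ xs) (_ ∷ u) = Unique-++⁻ʳ xs u

  Unique-++⇒disjoint : ∀ xs {ys : List A} {z} → Unique (xs ++ ys) → z ∈ xs → z ∉ ys
  Unique-++⇒disjoint (x ∷ xs) (x∉ ∷ _) (here refl) z∈ys = All-lookup x∉ (∈-++⁺ʳ xs z∈ys) refl
  Unique-++⇒disjoint (x ∷ xs) (_ ∷ u)  (there z∈xs) = Unique-++⇒disjoint xs u z∈xs

  data EndsAt (u : A) : List A → Set where
    here  : EndsAt u (u ∷ [])
    there : ∀ {y xs} → EndsAt u xs → EndsAt u (y ∷ xs)

  EndsAt⇒∈ : ∀ {u xs} → EndsAt u xs → u ∈ xs
  EndsAt⇒∈ here      = here refl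
  EndsAt⇒∈ (there e) = there (EndsAt⇒∈ e)

  EndsAt-ʳ++ : ∀ {u ys} xs → EndsAt u ys → EndsAt u (xs ʳ++ ys)
  EndsAt-ʳ++ []       e = e
  EndsAt-ʳ++ (x ∷ xs) e = EndsAt-ʳ++ xs (there e)

  EndsAt-++⁻ʳ : ∀ {u x ys} xs → EndsAt u (xs ++ x ∷ ys) → EndsAt u (x ∷ ys)
  EndsAt-++⁻ʳ []           e         = e
  EndsAt-++⁻ʳ (_ ∷ [])     (there e) = e
  EndsAt-++⁻ʳ (_ ∷ y ∷ xs) (there e) = EndsAt-++⁻ʳ (y ∷ xs) e

module _ {n : ℕ} (G : Graph n) where

  Chain-++⁻ˡ : ∀ xs {ys} → Chain G (xs ++ ys) → Chain G xs
  Chain-++⁻ˡ []           _       = []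
  Chain-++⁻ˡ (x ∷ [])     _       = [-] x
  Chain-++⁻ˡ (x ∷ y ∷ xs) (e ∷ c) = e ∷ Chain-++⁻ˡ (y ∷ xs) c

  Chain-++⁻ʳ : ∀ xs {ys} → Chain G (xs ++ ys) → Chain G ys
  Chain-++⁻ʳ []           c       = c
  Chain-++⁻ʳ (_ ∷ [])     (_ ∷ c) = c
  Chain-++⁻ʳ (_ ∷ [])     ([-] _) = []
  Chain-++⁻ʳ (_ ∷ y ∷ xs) (_ ∷ c) = Chain-++⁻ʳ (y ∷ xs) c

  Chain-ʳ++ : ∀ {x xs ys} → Chain G (x ∷ xs) → Chain G (x ∷ ys) → Chain G ((x ∷ xs) ʳ++ ys)
  Chain-ʳ++ ([-] _) c′ = c′
  Chain-ʳ++ (e ∷ c) c′ = Chain-ʳ++ c (Graph.sym G e ∷ c′)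

  Chain-reverse : ∀ {xs} → Chain G xs → Chain G (reverse xs)
  Chain-reverse []      = []
  Chain-reverse ([-] x) = [-] x
  Chain-reverse (e ∷ c) = Chain-ʳ++ (e ∷ c) ([-] _)

  StartsAt-ʳ++ : ∀ {u xs} → EndsAt u xs → ∀ ys → StartsAt G u (xs ʳ++ ys)
  StartsAt-ʳ++ here               ys = refl
  StartsAt-ʳ++ (there {y = y} e) ys = StartsAt-ʳ++ e (y ∷ ys)

  StartsAt⇒nonempty : ∀ {u xs} → StartsAt G u xs → ¬ xs ≡ []
  StartsAt⇒nonempty {xs = _ ∷ _} _ ()

  reverse-path : ∀ {u xs} → EndsAt u xs → Chain G xs → Unique xs →
                 IsPath G (reverse xs) × StartsAt G u (reverse xs)
  reverse-path {xs = xs} e c u = record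
    { nonempty = StartsAt⇒nonempty (StartsAt-ʳ++ e [])
    ; chain    = Chain-reverse c
    ; distinct = Unique-resp-↭ (↭-sym (↭-reverse xs)) u
    } , StartsAt-ʳ++ e []

  nonNeighbours-adjacent : ThreeK1Free G → ∀ {w p q} → ¬ w ≡ p → ¬ w ≡ q → ¬ p ≡ q →
                           ¬ Adj G w p → ¬ Adj G w q → Adj G p q
  nonNeighbours-adjacent k3 {w} {p} {q} w≢p w≢q p≢q w≁p w≁q with Graph.adj? G p q
  ... | yes p~q = p~q
  ... | no  p≁q = ⊥-elim (k3 w p q w≢p w≢q p≢q (w≁p , w≁q , p≁q))

module Covering {n : ℕ} (G : Graph n) where

  open import Data.List.Membership.DecPropositional (_≟_ {n}) using (_∈?_)

  V : Set
  V = Fin n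

  -- Both paths are stored reversed: their free ends p and q are the heads of the lists,
  -- and u, v are their last vertices.
  record PartialCover (u v : V) : Set where
    constructor partialCover
    field
      P Q      : List V
      P-ends   : EndsAt u P
      Q-ends   : EndsAt v Q
      P-chain  : Chain G P
      Q-chain  : Chain G Q
      distinct : Unique (P ++ Q)
  open PartialCover

  vertices : ∀ {u v} → PartialCover u v → List V
  vertices s = P s ++ Q s

  swap : ∀ {u v} → PartialCover u v → PartialCover v u
  swap (partialCover P Q pe qe pc qc d) = partialCover Q P qe pe qc pc (Unique-resp-↭ (++-comm P Q) d)

  vertices-swap : ∀ {u v} (s : PartialCover u v) → vertices (swap s) ↭ vertices s
  vertices-swap s = ++-comm (Q s) (P s)

  Extension : ∀ {u v} → PartialCover u v → V → Set
  Extension {u} {v} s w = Σ (PartialCover u v) λ s′ → w ∷ vertices s ⊆ vertices s′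

  extension-swap : ∀ {u v w} (s : PartialCover u v) → Extension (swap s) w → Extension s w
  extension-swap s (s′ , w∷s⊆s′) =
    swap s′ , ∈-resp-↭ (↭-sym (vertices-swap s′)) ∘ w∷s⊆s′ ∘ ∈-resp-↭ (↭-sym w∷swap)
    where w∷swap = ↭-prep _ (vertices-swap s)

  extend-end : ∀ {u v p P′ w} (s : PartialCover u v) → P s ≡ p ∷ P′ →
               Adj G w p → w ∉ vertices s → Extension s w
  extend-end (partialCover (p ∷ P′) Q pe qe pc qc d) refl w~p w∉ =
    partialCover (_ ∷ p ∷ P′) Q (there pe) qe (w~p ∷ pc) qc (¬Any⇒All¬ _ w∉ ∷ d) , λ x → x

  -- The joined path  u … x A⁻¹ p q … v  becomes the paths  u … x w  and  v … q p A.
  rotate : ∀ {u v w p x q} A B Q′ (s : PartialCover u v) →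
           P s ≡ p ∷ A ++ x ∷ B → Q s ≡ q ∷ Q′ → Adj G p q → Adj G x w →
           w ∉ vertices s → Extension s w
  rotate {w = w} {p} {x} {q} A B Q′ (partialCover _ _ pe qe pc qc d) refl refl p~q x~w w∉ =
    partialCover (w ∷ x ∷ B) ((p ∷ A) ʳ++ q ∷ Q′)
      (there (EndsAt-++⁻ʳ (p ∷ A) pe)) (EndsAt-ʳ++ (p ∷ A) qe)
      (Graph.sym G x~w ∷ Chain-++⁻ʳ G (p ∷ A) pc)
      (Chain-ʳ++ G (Chain-++⁻ˡ G (p ∷ A) pc) (p~q ∷ qc))
      (Unique-resp-↭ (↭-sym rearranged) (¬Any⇒All¬ _ w∉ ∷ d)) ,
    ∈-resp-↭ (↭-sym rearranged)
    where
    open PermutationReasoning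
    Qs = q ∷ Q′
    rearranged : (w ∷ x ∷ B) ++ ((p ∷ A) ʳ++ Qs) ↭ w ∷ (p ∷ A ++ x ∷ B) ++ Qs
    rearranged = begin
      (w ∷ x ∷ B) ++ ((p ∷ A) ʳ++ Qs)  ↭⟨ ++⁺ˡ (w ∷ x ∷ B) (↭-sym (++↭ʳ++ (p ∷ A) Qs)) ⟩
      w ∷ (x ∷ B) ++ (p ∷ A) ++ Qs     ↭⟨ ↭-prep w (shifts (x ∷ B) (p ∷ A)) ⟩
      w ∷ (p ∷ A) ++ (x ∷ B) ++ Qs     ≡⟨ cong (w ∷_) (++-assoc (p ∷ A) (x ∷ B) Qs) ⟨
      w ∷ (p ∷ A ++ x ∷ B) ++ Qs       ∎

  complete : ∀ {u v} (s : PartialCover u v) → (∀ x → x ∈ vertices s) → PathCover G u v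
  complete (partialCover P Q pe qe pc qc d) covered = record
    { P        = reverse P
    ; Q        = reverse Q
    ; P-path   = proj₁ P-reversed
    ; Q-path   = proj₁ Q-reversed
    ; P-start  = proj₂ P-reversed
    ; Q-start  = proj₂ Q-reversed
    ; disjoint = λ x x∈P x∈Q → Unique-++⇒disjoint P d (∈-resp-↭ (↭-reverse P) x∈P)
                                                     (∈-resp-↭ (↭-reverse Q) x∈Q)
    ; covers   = λ x → Sum.map (∈-resp-↭ (↭-sym (↭-reverse P))) (∈-resp-↭ (↭-sym (↭-reverse Q)))
                               (∈-++⁻ P (covered x))
    }
    where
    P-reversed = reverse-path G pe pc (Unique-++⁻ˡ P d)
    Q-reversed = reverse-path G qe qc (Unique-++⁻ʳ P d)

  module _ (k3 : ThreeK1Free G) where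

    extend-from-P : ∀ {u v x w} (s : PartialCover u v) → x ∈ P s → Adj G x w →
                    w ∉ vertices s → Extension s w
    extend-from-P (partialCover [] _ () _ _ _ _) _ _ _
    extend-from-P (partialCover (_ ∷ _) [] _ () _ _ _) _ _ _
    extend-from-P {w = w} s@(partialCover (p ∷ P′) (q ∷ Q′) _ _ _ _ d) x∈P x~w w∉
      with Graph.adj? G w p | Graph.adj? G w q
    ... | yes w~p | _       = extend-end s refl w~p w∉
    ... | no _    | yes w~q =
      extension-swap s (extend-end (swap s) refl w~q (w∉ ∘ ∈-resp-↭ (vertices-swap s)))
    ... | no w≁p  | no w≁q  with x∈P
    ...   | here refl   = ⊥-elim (w≁p (Graph.sym G x~w))
    ...   | there x∈P′ with ∈-∃++ x∈P′
    ...     | A , B , refl = rotate A B Q′ s refl refl p~q x~w w∉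
      where
      p~q : Adj G p q
      p~q = nonNeighbours-adjacent G k3 (w∉ ∘ here) (w∉ ∘ ∈-++⁺ʳ (p ∷ P′) ∘ here)
              (Unique[x∷xs]⇒x∉xs d ∘ ∈-++⁺ʳ P′ ∘ here) w≁p w≁q

    extend : ∀ {u v x w} (s : PartialCover u v) → x ∈ vertices s → Adj G x w →
             w ∉ vertices s → Extension s w
    extend s x∈ x~w w∉ with ∈-++⁻ (P s) x∈
    ... | inj₁ x∈P = extend-from-P s x∈P x~w w∉
    ... | inj₂ x∈Q =
      extension-swap s (extend-from-P (swap s) x∈Q x~w (w∉ ∘ ∈-resp-↭ (vertices-swap s)))

    reach : ∀ {u v a z} l (s : PartialCover u v) → Chain G (a ∷ l) → last (a ∷ l) ≡ just z →
            a ∈ vertices s → Σ (PartialCover u v) λ s′ → vertices s ⊆ vertices s′ × z ∈ vertices s′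
    reach []      s _         refl  a∈ = s , (λ x∈ → x∈) , a∈
    reach (b ∷ l) s (a~b ∷ c) last≡ a∈ with b ∈? vertices s
    ... | yes b∈ = reach l s c last≡ b∈
    ... | no  b∉ with extend s a∈ a~b b∉
    ...   | s₁ , b∷s⊆s₁ with reach l s₁ c last≡ (b∷s⊆s₁ (here refl))
    ...     | s₂ , s₁⊆s₂ , z∈ = s₂ , (λ x∈ → s₁⊆s₂ (b∷s⊆s₁ (there x∈))) , z∈

    module _ (conn : Connected G) where

      cover : ∀ {u v} (zs : List V) → PartialCover u v → Σ (PartialCover u v) λ s → zs ⊆ vertices s
      cover [] s = s , λ ()
      cover {u} (z ∷ zs) s with cover zs s
      ... | s₁ , zs⊆s₁ with conn u z
      ...   | a ∷ l , path , refl , last≡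
            with reach l s₁ (IsPath.chain path) last≡ (∈-++⁺ˡ (EndsAt⇒∈ (P-ends s₁)))
      ...     | s₂ , s₁⊆s₂ , z∈s₂ = s₂ , λ { (here refl) → z∈s₂ ; (there z∈zs) → s₁⊆s₂ (zs⊆s₁ z∈zs) }

theorem3 : (n : ℕ) (G : Graph n) → Connected G → ThreeK1Free G →
    (u v : Fin n) → ¬ (u ≡ v) → PathCover G u v
theorem3 n G conn k3 u v u≢v =
  let s , allFin⊆s = cover k3 conn (allFin n) initial
  in  complete s (λ x → allFin⊆s (∈-allFin x))
  where
  open Covering G
  initial : PartialCover u v
  initial = partialCover (u ∷ []) (v ∷ []) here here ([-] u) ([-] v) ((u≢v ∷ []) ∷ [] ∷ [])
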